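{- Let $P$ be a $2,3,4$-program with $n$ clauses having the maximum number of stable models among all $2,3,4$-programs with $n$ clauses. Then, up to renaming atoms: if $n=3k$ with $k\ge1$, $P=A(k)$; if $n=3k+1$ with $k\ge1$, $P=C(k)$ or $P=C'(k)$; if $n=3k+2$ with $k\ge0$, $P=B(k)$. Consequently, the maximum number of stable models of a $2,3,4$-program with $n$ clauses is \[ s_0(n) = \begin{cases} 3\cdot 3^{\lfloor n/3\rfloor -1} & n\equiv 0 \pmod 3,\\ 4\cdot 3^{\lfloor n/3\rfloor -1} & n\equiv 1 \pmod 3,\\ 6\cdot 3^{\lfloor n/3\rfloor -1} & n\equiv 2 \pmod 3.\end{cases}\]
   Context: A (normal) logic program is a finite set of clauses $a\leftarrow b_1,\ldots,b_m,\mathbf{not}(c_1),\ldots,\mathbf{not}(c_k)$ with atoms $a,b_i,c_j$. For a set of atoms $M$, the reduct $P^M$ is obtained by deleting every clause whose body contains $\mathbf{not}(c)$ with $c\in M$ and deleting all negative literals from the remaining clauses; $M$ is a stable model of $P$ if $M$ is the least model of $P^M$. For $A=\{a_1,\ldots,a_k\}$, $CP[A]$ consists of the clauses $a_i\leftarrow\mathbf{not}(a_1),\ldots,\mathbf{not}(a_{i-1}),\mathbf{not}(a_{i+1}),\ldots,\mathbf{not}(a_k)$, $i=1,\ldots,k$. A $2,3,4$-program is a program whose atom set can be partitioned into pairwise disjoint sets $A_1,\ldots,A_l$ with $2\le|A_i|\le4$ such that $P=\bigcup_iCP[A_i]$; its signature $\langle\lambda_2,\lambda_3,\lambda_4\rangle$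 counts the $A_i$ of each size. Up to renaming atoms it is determined by its signature. $A(k)$, $C(k)$, $C'(k)$ ($k\ge1$) are the $2,3,4$-programs with signatures $\langle0,k,0\rangle$, $\langle2,k-1,0\rangle$, $\langle0,k-1,1\rangle$; $B(k)$ ($k\ge0$) has signature $\langle1,k,0\rangle$. -}

module Defs where

open import Data.Nat using (ℕ; zero; suc; _+_; _*_; _^_; _≤_; _≟_)
open import Data.Fin using (Fin)
import Data.Fin.Properties as FinP
open import Data.Fin.Subset as S using (Subset)
open import Data.Fin.Subset.Properties using (_∈?_)
open import Data.List using (List; []; _∷_; map; filter; length; concat; concatMap; allFin)
open import Data.List.Relation.Unary.All using (All; all?)
open import Data.List.Relation.Unary.Unique.Propositional using (Unique)
open import Data.List.Relation.Binary.Permutation.Propositional using (_↭_)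
import Data.List.Membership.Propositional as LM
open import Data.Product using (Σ; ∃; _×_; _,_)
open import Data.Sum using (_⊎_)
open import Relation.Nullary using (¬?)
open import Relation.Binary.PropositionalEquality using (_≡_)
open import Function.Bundles using (_⇔_)

record Clause (m : ℕ) : Set where
  constructor _⟵_,not_
  field
    head : Fin m
    pos  : List (Fin m)
    neg  : List (Fin m)
open Clause public

Program : ℕ → Set
Program m = List (Clause m)

record DefClause (m : ℕ) : Set where
  constructor _⟵_
  field
    dhead : Fin m
    dbody : List (Fin m)
open DefClause public

reduct : ∀ {m} → Program m → Subset m → List (DefClause m)
reduct P M = map (λ c → head c ⟵ pos c)
                 (filter (λ c → all? (λ a → ¬? (a ∈? M)) (neg c)) P)

IsModel : ∀ {m} → List (DefClause m) → Subset m → Set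
IsModel Q N = All (λ d → All (λ b → b S.∈ N) (dbody d) → dhead d S.∈ N) Q

IsLeastModel : ∀ {m} → List (DefClause m) → Subset m → Set
IsLeastModel Q M = IsModel Q M × (∀ N → IsModel Q N → M S.⊆ N)

IsStable : ∀ {m} → Program m → Subset m → Set
IsStable P M = IsLeastModel (reduct P M) M

NumStable : ∀ {m} → Program m → ℕ → Set
NumStable {m} P s =
  Σ (List (Subset m)) λ L → Unique L × (∀ M → (M LM.∈ L) ⇔ IsStable P M) × length L ≡ s

CP : ∀ {m} → List (Fin m) → Program m
CP A = map (λ a → a ⟵ [] ,not (filter (λ b → ¬? (b FinP.≟ a)) A)) A

IsPartition234 : ∀ {m} → List (List (Fin m)) → Set
IsPartition234 {m} Bs = All (λ A → 2 ≤ length A × length A ≤ 4) Bs × concat Bs ↭ allFin m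

countSize : ∀ {m} → ℕ → List (List (Fin m)) → ℕ
countSize i Bs = length (filter (λ A → length A ≟ i) Bs)

HasSignature : ∀ {m} → Program m → ℕ → ℕ → ℕ → Set
HasSignature {m} P l2 l3 l4 =
  Σ (List (List (Fin m))) λ Bs → IsPartition234 Bs × P ↭ concatMap CP Bs
    × countSize 2 Bs ≡ l2 × countSize 3 Bs ≡ l3 × countSize 4 Bs ≡ l4

Is234 : ∀ {m} → Program m → Set
Is234 P = ∃ λ l2 → ∃ λ l3 → ∃ λ l4 → HasSignature P l2 l3 l4

IsMaximal : ℕ → ∀ {m} → Program m → Set
IsMaximal n P = Is234 P × length P ≡ n × ∃ λ s → NumStable P s ×
  (∀ m' (P' : Program m') → Is234 P' → length P' ≡ n → ∀ s' → NumStable P' s' → s' ≤ s)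

-- s₀(n) for n ≥ 2 (n = 3k, k ≥ 1: 3·3^(k-1) = 3^k;  n = 3k+1, k ≥ 1: 4·3^(k-1);
-- n = 3k+2, k ≥ 0: 6·3^(k-1) = 2·3^k).  Values for n < 2 are irrelevant (junk).
s₀ : ℕ → ℕ
s₀ 0 = 1
s₀ 1 = 1
s₀ 2 = 2
s₀ 3 = 3
s₀ 4 = 4
s₀ (suc (suc (suc n@(suc (suc _))))) = 3 * s₀ n

{-# OPTIONS --safe #-}

-- A 2,3,4-program with blocks A₁, …, Aₗ has Σ |Aᵢ| clauses, and its stable models are exactly
-- the sets that contain one atom of each block, so it has Π |Aᵢ| of them.  The theorem thus
-- becomes the problem of maximising 2^λ₂ 3^λ₃ 4^λ₄ subject to 2λ₂ + 3λ₃ + 4λ₄ = n.  Trading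
-- 2+2+2 or 2+4 for 3+3, or 4+4 for 2+3+3, keeps the sum and multiplies the product by 9/8, so a
-- maximiser has λ₂ ≤ 2, λ₄ ≤ 1 and λ₂ λ₄ = 0, and then n mod 3 determines it.  That s₀ bounds
-- the product follows by induction on the blocks from d · s₀(t) ≤ s₀(d + t) for d = 2, 3, 4.

module Submission where

open import Defs
open import Data.Bool using (true; false)
open import Data.Empty using (⊥-elim)
open import Data.Fin using (Fin)
import Data.Fin.Properties as Fin
open import Data.Fin.Subset
  using (Subset; outside; _∈_; _∉_; _⊆_; ⁅_⁆; _∪_; _─_; _-_) renaming (⊥ to ∅)
open import Data.Fin.Subset.Properties
  using (_∈?_; ⊆-antisym; ∉⊥; x∈⁅x⁆; x∈⁅y⁆⇒x≡y; x∈p∪q⁻; x∈p∪q⁺; x∈p∧x≢y⇒x∈p-y; p─q⊆p)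
open import Data.List
  using (List; []; _∷_; [_]; _++_; map; filter; length; concat; concatMap; foldr; take; drop;
         allFin; cartesianProductWith)
open import Data.List.Properties
  using (length-++; length-map; length-take; length-drop; take++drop≡id; length-tabulate)
open import Data.List.Relation.Unary.All as All using (All; []; _∷_; all?)
import Data.List.Relation.Unary.All.Properties as All
open import Data.List.Relation.Unary.Any using (Any; here; there; any?)
open import Data.List.Relation.Unary.Unique.Propositional using (Unique; []; _∷_)
import Data.List.Relation.Unary.Unique.Propositional.Properties as Unique
open import Data.List.Relation.Binary.Disjoint.Propositional using (Disjoint)
open import Data.List.Relation.Binary.Permutation.Propositional
  using (_↭_; ↭-refl; ↭-sym; ↭-reflexive; ↭⇒↭ₛ)
import Data.List.Relation.Binary.Permutation.Propositional.Properties as ↭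
import Data.List.Relation.Binary.Permutation.Setoid.Properties as ↭ₛ
open import Data.List.Relation.Binary.BagAndSetEquality using (∼bag⇒↭)
open import Data.List.Membership.Propositional using (find; lose) renaming (_∈_ to _∈ₗ_)
open import Data.List.Membership.Propositional.Properties
open import Data.List.Membership.Propositional.Properties.WithK using (unique∧set⇒bag)
open import Data.Nat using (ℕ; suc; _+_; _*_; _^_; _∸_; _⊓_; _≤_; _<_; z≤n; s≤s; _≟_; _%_)
open import Data.Nat.Properties
  using (≤-refl; ≤-trans; <-irrefl; ≤-<-trans; ≤ᵇ⇒≤; m≤m+n; m<n+m; m≤n⇒m⊓n≡m; m+n∸m≡n; m^n>0;
         +-comm; *-comm; *-assoc; +-identityʳ; +-cancelʳ-≡; *-cancelˡ-≡; *-mono-≤; *-monoʳ-≤;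
         module ≤-Reasoning)
open import Data.Nat.DivMod using ([m+kn]%n≡m%n; m<n⇒m%n≡m)
open import Data.Nat.ListAction using (sum; product)
open import Data.Nat.Tactic.RingSolver using (solve-∀)
open import Data.Product using (Σ; ∃; _×_; _,_; proj₁; proj₂; map₁; map₂)
open import Data.Sum as Sum using (_⊎_; inj₁; inj₂; [_,_]′)
open import Data.Vec using (_∷_; here; there)
open import Function using (id; _∘_; flip; _⇔_; mk⇔; Equivalence)
import Function.Properties.Equivalence as ⇔
open import Relation.Nullary using (Dec; does; yes; no; ¬?; contradiction)
open import Relation.Binary.PropositionalEquality
  using (_≡_; _≢_; refl; sym; trans; cong; cong₂; subst; subst₂; module ≡-Reasoning)
import Relation.Binary.PropositionalEquality as ≡

open Equivalence

private
  variable
    A B C : Set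

unique-++⁻ : ∀ (xs : List A) {ys} → Unique (xs ++ ys) → Unique xs × Unique ys × Disjoint xs ys
unique-++⁻ []       u          = [] , u , λ ()
unique-++⁻ (x ∷ xs) (x∉ ∷ u) with unique-++⁻ xs u
... | uxs , uys , disjoint = All.++⁻ˡ xs x∉ ∷ uxs , uys , λ
  { (here refl , v∈ys)  → All.lookup (All.++⁻ʳ xs x∉) v∈ys refl
  ; (there v∈xs , v∈ys) → disjoint (v∈xs , v∈ys)
  }

unique-map : ∀ (f : A → B) {xs} → (∀ {x y} → x ∈ₗ xs → y ∈ₗ xs → f x ≡ f y → x ≡ y) →
             Unique xs → Unique (map f xs)
unique-map f inj []         = []
unique-map f inj (x∉ ∷ u) =
  All.map⁺ (All.tabulate λ y∈ fx≡fy → All.lookup x∉ y∈ (inj (here refl) (there y∈) fx≡fy))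
  ∷ unique-map f (λ p q → inj (there p) (there q)) u

-- Unlike the library's cartesianProductWith⁺, injectivity is only required on list members.
unique-cartesianProductWith :
  ∀ (f : A → B → C) {xs ys} →
  (∀ {w x y z} → w ∈ₗ xs → x ∈ₗ xs → y ∈ₗ ys → z ∈ₗ ys → f w y ≡ f x z → w ≡ x × y ≡ z) →
  Unique xs → Unique ys → Unique (cartesianProductWith f xs ys)
unique-cartesianProductWith f inj [] uys = []
unique-cartesianProductWith f {x ∷ xs} {ys} inj (x∉ ∷ uxs) uys =
  Unique.++⁺ (unique-map (f x) (λ p q → proj₂ ∘ inj (here refl) (here refl) p q) uys)
             (unique-cartesianProductWith f (λ p q → inj (there p) (there q)) uxs uys)
             disjoint
  where
  disjoint : Disjoint (map (f x) ys) (cartesianProductWith f xs ys)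
  disjoint (v∈ , v∈′) with ∈-map⁻ (f x) v∈ | ∈-cartesianProductWith⁻ f xs ys v∈′
  ... | y , y∈ , refl | w , z , w∈ , z∈ , eq =
    All.lookup x∉ w∈ (proj₁ (inj (here refl) (there w∈) y∈ z∈ eq))

length-cartesianProductWith : ∀ (f : A → B → C) xs ys →
                              length (cartesianProductWith f xs ys) ≡ length xs * length ys
length-cartesianProductWith f []       ys = refl
length-cartesianProductWith f (x ∷ xs) ys =
  trans (length-++ (map (f x) ys))
        (cong₂ _+_ (length-map (f x) ys) (length-cartesianProductWith f xs ys))

chunks : List ℕ → List A → List (List A)
chunks []       _  = []
chunks (d ∷ ds) xs = take d xs ∷ chunks ds (drop d xs)

module _ (d : ℕ) {n} {xs : List A} (len : length xs ≡ d + n) where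

  length-take≡ : length (take d xs) ≡ d
  length-take≡ = trans (length-take d xs) (trans (cong (d ⊓_) len) (m≤n⇒m⊓n≡m (m≤m+n d n)))

  length-drop≡ : length (drop d xs) ≡ n
  length-drop≡ = trans (length-drop d xs) (trans (cong (_∸ d) len) (m+n∸m≡n d n))

concat-chunks : ∀ ds (xs : List A) → length xs ≡ sum ds → concat (chunks ds xs) ≡ xs
concat-chunks []       []  _   = refl
concat-chunks (d ∷ ds) xs  len =
  trans (cong (take d xs ++_) (concat-chunks ds (drop d xs) (length-drop≡ d len)))
        (take++drop≡id d xs)

map-length-chunks : ∀ ds (xs : List A) → length xs ≡ sum ds → map length (chunks ds xs) ≡ ds
map-length-chunks []       _  _   = refl
map-length-chunks (d ∷ ds) xs len =
  cong₂ _∷_ (length-take≡ d len) (map-length-chunks ds (drop d xs) (length-drop≡ d len))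

x∈p─q⇒x∉q : ∀ {n} {x : Fin n} (p q : Subset n) → x ∈ p ─ q → x ∉ q
x∈p─q⇒x∉q (_ ∷ p) (outside ∷ q) here       ()
x∈p─q⇒x∉q (_ ∷ p) (_ ∷ q)       (there x∈) (there x∈q) = x∈p─q⇒x∉q p q x∈ x∈q

module _ {m : ℕ} where

  fromList : List (Fin m) → Subset m
  fromList = foldr (λ x M → ⁅ x ⁆ ∪ M) ∅

  ∈-fromList⁺ : ∀ {x xs} → x ∈ₗ xs → x ∈ fromList xs
  ∈-fromList⁺ (here refl) = x∈p∪q⁺ (inj₁ (x∈⁅x⁆ _))
  ∈-fromList⁺ (there x∈) = x∈p∪q⁺ (inj₂ (∈-fromList⁺ x∈))

  ∈-fromList⁻ : ∀ {x} xs → x ∈ fromList xs → x ∈ₗ xs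
  ∈-fromList⁻ []       x∈ = contradiction x∈ ∉⊥
  ∈-fromList⁻ (y ∷ xs) x∈ with x∈p∪q⁻ ⁅ y ⁆ (fromList xs) x∈
  ... | inj₁ x∈⁅y⁆ = here (x∈⁅y⁆⇒x≡y y x∈⁅y⁆)
  ... | inj₂ x∈xs  = there (∈-fromList⁻ xs x∈xs)

  ∈-⁅⁆∪⁻ : ∀ {x y} (p : Subset m) → x ∈ ⁅ y ⁆ ∪ p → x ≡ y ⊎ x ∈ p
  ∈-⁅⁆∪⁻ {y = y} p x∈ = Sum.map₁ (x∈⁅y⁆⇒x≡y y) (x∈p∪q⁻ ⁅ y ⁆ p x∈)

  ⁅⁆∪-injective : ∀ {x y} {p q : Subset m} → x ∉ q → y ∉ p → ⁅ x ⁆ ∪ p ≡ ⁅ y ⁆ ∪ q → x ≡ y × p ≡ q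
  ⁅⁆∪-injective {x} {y} {p} {q} x∉q y∉p eq = x≡y , ⊆-antisym p⊆q q⊆p
    where
    x≡y : x ≡ y
    x≡y with ∈-⁅⁆∪⁻ q (subst (x ∈_) eq (x∈p∪q⁺ (inj₁ (x∈⁅x⁆ x))))
    ... | inj₁ x≡y = x≡y
    ... | inj₂ x∈q = contradiction x∈q x∉q
    p⊆q : p ⊆ q
    p⊆q {z} z∈p with ∈-⁅⁆∪⁻ q (subst (z ∈_) eq (x∈p∪q⁺ (inj₂ z∈p)))
    ... | inj₁ refl = contradiction z∈p y∉p
    ... | inj₂ z∈q  = z∈q
    q⊆p : q ⊆ p
    q⊆p {z} z∈q with ∈-⁅⁆∪⁻ p (subst (z ∈_) (sym eq) (x∈p∪q⁺ (inj₂ z∈q)))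
    ... | inj₁ refl = contradiction z∈q x∉q
    ... | inj₂ z∈p  = z∈p

  x∈p-y⇒x≢y : ∀ {x y} {p : Subset m} → x ∈ p - y → x ≢ y
  x∈p-y⇒x≢y {p = p} x∈ refl = x∈p─q⇒x∉q p _ x∈ (x∈⁅x⁆ _)

  ⁅x⁆∪p-x≡p : ∀ {x} {p : Subset m} → x ∈ p → ⁅ x ⁆ ∪ (p - x) ≡ p
  ⁅x⁆∪p-x≡p {x} {p} x∈p = ⊆-antisym ⊆p p⊆
    where
    ⊆p : ⁅ x ⁆ ∪ (p - x) ⊆ p
    ⊆p y∈ with ∈-⁅⁆∪⁻ (p - x) y∈
    ... | inj₁ refl = x∈p
    ... | inj₂ y∈p-x = p─q⊆p p ⁅ x ⁆ y∈p-x
    p⊆ : p ⊆ ⁅ x ⁆ ∪ (p - x)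
    p⊆ {y} y∈p with y Fin.≟ x
    ... | yes refl = x∈p∪q⁺ (inj₁ (x∈⁅x⁆ x))
    ... | no y≢x   = x∈p∪q⁺ (inj₂ (x∈p∧x≢y⇒x∈p-y y∈p y≢x))

-- Stable models

module _ {m : ℕ} where

  heads : List (DefClause m) → List (Fin m)
  heads = map dhead

  isModel-heads : ∀ {Q N} → (∀ {x} → x ∈ₗ heads Q → x ∈ N) → IsModel Q N
  isModel-heads h = All.tabulate λ d∈Q _ → h (∈-map⁺ dhead d∈Q)

  heads-isModel : ∀ {Q N x} → All (λ d → dbody d ≡ []) Q → IsModel Q N → x ∈ₗ heads Q → x ∈ N
  heads-isModel {N = N} facts model x∈ with ∈-map⁻ dhead x∈
  ... | d , d∈Q , refl =
    All.lookup model d∈Q (subst (All (_∈ N)) (sym (All.lookup facts d∈Q)) [])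

  leastModel⇔heads : ∀ {Q M} → All (λ d → dbody d ≡ []) Q →
                     IsLeastModel Q M ⇔ (∀ x → x ∈ M ⇔ x ∈ₗ heads Q)
  leastModel⇔heads {Q} facts = mk⇔
    (λ (model , least) x → mk⇔
      (λ x∈M → ∈-fromList⁻ (heads Q) (least (fromList (heads Q)) (isModel-heads ∈-fromList⁺) x∈M))
      (heads-isModel facts model))
    (λ M≈heads → isModel-heads (from (M≈heads _))
               , λ N model {x} x∈M → heads-isModel facts model (to (M≈heads x) x∈M))

  Supported : Program m → Subset m → Fin m → Set
  Supported P M x = x ∈ₗ heads (reduct P M)

  stable⇔supported : ∀ {P M} → All (λ c → pos c ≡ []) P →
                     IsStable P M ⇔ (∀ x → x ∈ M ⇔ Supported P M x)
  stable⇔supported noPos = leastModel⇔heads (All.map⁺ (All.filter⁺ _ noPos))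

  supported-↭ : ∀ {P P′ M x} → P ↭ P′ → Supported P M x → Supported P′ M x
  supported-↭ P↭P′ = ↭.∈-resp-↭ (↭.map⁺ dhead (↭.map⁺ _ (↭.filter-↭ _ P↭P′)))

  numStable-unique : ∀ {P : Program m} {s t} → NumStable P s → NumStable P t → s ≡ t
  numStable-unique (L , uL , L≈stable , refl) (L′ , uL′ , L′≈stable , refl) =
    ↭.↭-length (∼bag⇒↭ (unique∧set⇒bag uL uL′ (⇔.trans (L≈stable _) (⇔.sym (L′≈stable _)))))

-- Stable models of CP[A₁] ∪ ⋯ ∪ CP[Aₗ]

module _ {m : ℕ} where

  Selected : List (List (Fin m)) → Subset m → Fin m → Set
  Selected Bs M x = ∃ λ A → A ∈ₗ Bs × x ∈ₗ A × (∀ {y} → y ∈ₗ A → y ≢ x → y ∉ M)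

  IsStableCP : List (List (Fin m)) → Subset m → Set
  IsStableCP Bs M = ∀ x → x ∈ M ⇔ Selected Bs M x

  private
    unblocked? : (M : Subset m) (c : Clause m) → Dec (All (_∉ M) (neg c))
    unblocked? M c = all? (λ a → ¬? (a ∈? M)) (neg c)

    cpClause : List (Fin m) → Fin m → Clause m
    cpClause A a = a ⟵ [] ,not (filter (λ b → ¬? (b Fin.≟ a)) A)

  supported-CP⇔selected : ∀ {Bs M x} → Supported (concatMap CP Bs) M x ⇔ Selected Bs M x
  supported-CP⇔selected {Bs} {M} {x} = mk⇔ selected supported
    where
    selected : Supported (concatMap CP Bs) M x → Selected Bs M x
    selected x∈
      with d , d∈ , refl ← ∈-map⁻ dhead x∈
      with c , c∈ , refl ← ∈-map⁻ (λ c → head c ⟵ pos c) d∈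
      with c∈CPs , unblocked ← ∈-filter⁻ (unblocked? M) {xs = concatMap CP Bs} c∈
      with A , A∈Bs , c∈CP ← find (∈-concatMap⁻ CP {xs = Bs} c∈CPs)
      with a , a∈A , refl ← ∈-map⁻ (cpClause A) c∈CP
      = A , A∈Bs , a∈A , λ y∈A y≢a → All.lookup unblocked (∈-filter⁺ (λ b → ¬? (b Fin.≟ a)) y∈A y≢a)
    supported : Selected Bs M x → Supported (concatMap CP Bs) M x
    supported (A , A∈Bs , x∈A , others∉M) =
      ∈-map⁺ dhead (∈-map⁺ (λ c → head c ⟵ pos c) (∈-filter⁺ (unblocked? M) c∈CPs unblocked))
      where
      c∈CPs : cpClause A x ∈ₗ concatMap CP Bs
      c∈CPs = ∈-concatMap⁺ CP {xs = Bs} (lose A∈Bs (∈-map⁺ (cpClause A) x∈A))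
      unblocked : All (_∉ M) (neg (cpClause A x))
      unblocked = All.tabulate λ y∈ → let y∈A , y≢x = ∈-filter⁻ (λ b → ¬? (b Fin.≟ x)) {xs = A} y∈
                                      in others∉M y∈A y≢x

  stable⇔stableCP : ∀ {P Bs M} → P ↭ concatMap CP Bs → IsStable P M ⇔ IsStableCP Bs M
  stable⇔stableCP {P} {Bs} {M} P↭CPs = ⇔.trans (stable⇔supported noPos) (mk⇔
    (λ M≈supported x → ⇔.trans (M≈supported x) supported⇔selected)
    (λ M≈selected x → ⇔.trans (M≈selected x) (⇔.sym supported⇔selected)))
    where
    noPos : All (λ c → pos c ≡ []) P
    noPos = ↭.All-resp-↭ (↭-sym P↭CPs) (All.concat⁺ (All.map⁺ (All.universal noPosCP Bs)))
      where
      noPosCP : ∀ A → All (λ c → pos c ≡ []) (CP A)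
      noPosCP A = All.map⁺ (All.universal (λ _ → refl) A)
    supported⇔selected : ∀ {x} → Supported P M x ⇔ Selected Bs M x
    supported⇔selected =
      ⇔.trans (mk⇔ (supported-↭ P↭CPs) (supported-↭ (↭-sym P↭CPs))) supported-CP⇔selected

  stableModelsCP : List (List (Fin m)) → List (Subset m)
  stableModelsCP []       = [ ∅ ]
  stableModelsCP (A ∷ Bs) = cartesianProductWith (λ a M → ⁅ a ⁆ ∪ M) A (stableModelsCP Bs)

  length-stableModelsCP : ∀ Bs → length (stableModelsCP Bs) ≡ product (map length Bs)
  length-stableModelsCP []       = refl
  length-stableModelsCP (A ∷ Bs) =
    trans (length-cartesianProductWith _ A (stableModelsCP Bs))
          (cong (length A *_) (length-stableModelsCP Bs))

  isStableCP-[] : IsStableCP [] ∅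
  isStableCP-[] x = mk⇔ (λ x∈∅ → contradiction x∈∅ ∉⊥) λ ()

  isStableCP-[]⁻ : ∀ {M} → IsStableCP [] M → M ≡ ∅
  isStableCP-[]⁻ {M} stable = ⊆-antisym M⊆∅ (λ x∈∅ → contradiction x∈∅ ∉⊥)
    where
    M⊆∅ : M ⊆ ∅
    M⊆∅ {x} x∈M with () ← to (stable x) x∈M

  isStableCP⇒⊆concat : ∀ {Bs M x} → IsStableCP Bs M → x ∈ M → x ∈ₗ concat Bs
  isStableCP⇒⊆concat stable x∈M with A , A∈Bs , x∈A , _ ← to (stable _) x∈M = ∈-concat⁺′ x∈A A∈Bs

  isStableCP-∷⁺ : ∀ {A Bs a M} → a ∈ₗ A → Disjoint A (concat Bs) →
                  IsStableCP Bs M → IsStableCP (A ∷ Bs) (⁅ a ⁆ ∪ M)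
  isStableCP-∷⁺ {A} {Bs} {a} {M} a∈A A#Bs stable x = mk⇔ selected member
    where
    ∉-Bs : ∀ {y} → y ∈ₗ A → y ∉ M
    ∉-Bs y∈A y∈M = A#Bs (y∈A , isStableCP⇒⊆concat stable y∈M)
    selected : x ∈ ⁅ a ⁆ ∪ M → Selected (A ∷ Bs) (⁅ a ⁆ ∪ M) x
    selected x∈ with ∈-⁅⁆∪⁻ M x∈
    ... | inj₁ refl = A , here refl , a∈A , λ y∈A y≢a y∈ →
      [ y≢a , ∉-Bs y∈A ]′ (∈-⁅⁆∪⁻ M y∈)
    ... | inj₂ x∈M with B , B∈Bs , x∈B , others∉M ← to (stable x) x∈M =
      B , there B∈Bs , x∈B , λ y∈B y≢x y∈ →
      [ (λ { refl → A#Bs (a∈A , ∈-concat⁺′ y∈B B∈Bs) }) , others∉M y∈B y≢x ]′ (∈-⁅⁆∪⁻ M y∈)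
    member : Selected (A ∷ Bs) (⁅ a ⁆ ∪ M) x → x ∈ ⁅ a ⁆ ∪ M
    member (_ , here refl , x∈A , others∉) with x Fin.≟ a
    ... | yes refl = x∈p∪q⁺ (inj₁ (x∈⁅x⁆ x))
    ... | no x≢a   = contradiction (x∈p∪q⁺ (inj₁ (x∈⁅x⁆ a))) (others∉ a∈A (x≢a ∘ sym))
    member (B , there B∈Bs , x∈B , others∉) =
      x∈p∪q⁺ (inj₂ (from (stable x) (B , B∈Bs , x∈B , λ y∈B y≢x → others∉ y∈B y≢x ∘ x∈p∪q⁺ ∘ inj₂)))

  -- a₀ only witnesses that A is non-empty.
  isStableCP-∷⁻ : ∀ {A Bs M a₀} → a₀ ∈ₗ A → Disjoint A (concat Bs) → IsStableCP (A ∷ Bs) M →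
                  ∃ λ a → a ∈ₗ A × a ∈ M × IsStableCP Bs (M - a)
  isStableCP-∷⁻ {A} {Bs} {M} {a₀} a₀∈A A#Bs stable = a , a∈A , a∈M , stable′
    where
    some∈M : Any (_∈ M) A
    some∈M with any? (_∈? M) A
    ... | yes some = some
    ... | no none  = contradiction (lose a₀∈A a₀∈M) none
      where
      a₀∈M : a₀ ∈ M
      a₀∈M = from (stable a₀) (A , here refl , a₀∈A , λ y∈A _ y∈M → none (lose y∈A y∈M))
    a = proj₁ (find some∈M)
    a∈A = proj₁ (proj₂ (find some∈M))
    a∈M = proj₂ (proj₂ (find some∈M))
    others∉M : ∀ {y} → y ∈ₗ A → y ≢ a → y ∉ M
    others∉M with to (stable a) a∈M
    ... | _ , here refl , _ , others∉ = others∉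
    ... | B , there B∈Bs , a∈B , _ = contradiction (a∈A , ∈-concat⁺′ a∈B B∈Bs) A#Bs
    stable′ : IsStableCP Bs (M - a)
    stable′ x = mk⇔ selected member
      where
      selected : x ∈ M - a → Selected Bs (M - a) x
      selected x∈ with to (stable x) (p─q⊆p M _ x∈)
      ... | _ , here refl , x∈A , _ = contradiction (p─q⊆p M _ x∈) (others∉M x∈A (x∈p-y⇒x≢y x∈))
      ... | B , there B∈Bs , x∈B , others∉ =
        B , B∈Bs , x∈B , λ y∈B y≢x → others∉ y∈B y≢x ∘ p─q⊆p M _
      member : Selected Bs (M - a) x → x ∈ M - a
      member (B , B∈Bs , x∈B , others∉) = x∈p∧x≢y⇒x∈p-y x∈M (∉A x∈B)
        where
        ∉A : ∀ {y} → y ∈ₗ B → y ≢ a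
        ∉A y∈B refl = A#Bs (a∈A , ∈-concat⁺′ y∈B B∈Bs)
        x∈M : x ∈ M
        x∈M = from (stable x) (B , there B∈Bs , x∈B , λ y∈B y≢x y∈M →
                                 others∉ y∈B y≢x (x∈p∧x≢y⇒x∈p-y y∈M (∉A y∈B)))

  stableModelsCP-sound : ∀ Bs {M} → Unique (concat Bs) → M ∈ₗ stableModelsCP Bs → IsStableCP Bs M
  stableModelsCP-sound []       _ (here refl) = isStableCP-[]
  stableModelsCP-sound (A ∷ Bs) u M∈
    with _ , uBs , A#Bs ← unique-++⁻ A u
    with a , M′ , a∈A , M′∈ , refl ← ∈-cartesianProductWith⁻ _ A (stableModelsCP Bs) M∈
    = isStableCP-∷⁺ a∈A A#Bs (stableModelsCP-sound Bs uBs M′∈)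

  stableModelsCP-complete : ∀ Bs {M} → Unique (concat Bs) → All (λ A → ∃ (_∈ₗ A)) Bs →
                            IsStableCP Bs M → M ∈ₗ stableModelsCP Bs
  stableModelsCP-complete []       _ _ stable = here (isStableCP-[]⁻ stable)
  stableModelsCP-complete (A ∷ Bs) u ((_ , a₀∈A) ∷ inhabited) stable
    with _ , uBs , A#Bs ← unique-++⁻ A u
    with a , a∈A , a∈M , stable′ ← isStableCP-∷⁻ a₀∈A A#Bs stable
    = subst (_∈ₗ stableModelsCP (A ∷ Bs)) (⁅x⁆∪p-x≡p a∈M)
        (∈-cartesianProductWith⁺ _ a∈A (stableModelsCP-complete Bs uBs inhabited stable′))

  unique-stableModelsCP : ∀ Bs → Unique (concat Bs) → Unique (stableModelsCP Bs)
  unique-stableModelsCP []       _ = [] ∷ []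
  unique-stableModelsCP (A ∷ Bs) u with uA , uBs , A#Bs ← unique-++⁻ A u =
    unique-cartesianProductWith _ injective uA (unique-stableModelsCP Bs uBs)
    where
    ∉model : ∀ {a M} → a ∈ₗ A → M ∈ₗ stableModelsCP Bs → a ∉ M
    ∉model a∈A M∈ a∈M = A#Bs (a∈A , isStableCP⇒⊆concat (stableModelsCP-sound Bs uBs M∈) a∈M)
    injective : ∀ {a b M N} → a ∈ₗ A → b ∈ₗ A → M ∈ₗ stableModelsCP Bs → N ∈ₗ stableModelsCP Bs →
                ⁅ a ⁆ ∪ M ≡ ⁅ b ⁆ ∪ N → a ≡ b × M ≡ N
    injective a∈A b∈A M∈ N∈ = ⁅⁆∪-injective (∉model a∈A N∈) (∉model b∈A M∈)

  numStable-CP : ∀ {P Bs} → P ↭ concatMap CP Bs → Unique (concat Bs) → All (λ A → ∃ (_∈ₗ A)) Bs →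
                 NumStable P (product (map length Bs))
  numStable-CP {Bs = Bs} P↭CPs u inhabited =
    stableModelsCP Bs , unique-stableModelsCP Bs u ,
    (λ M → ⇔.trans (mk⇔ (stableModelsCP-sound Bs u) (stableModelsCP-complete Bs u inhabited))
                   (⇔.sym (stable⇔stableCP P↭CPs))) ,
    length-stableModelsCP Bs

-- Maximising 2^λ₂ 3^λ₃ 4^λ₄ subject to 2λ₂ + 3λ₃ + 4λ₄ = n

data Size234 : ℕ → Set where
  two   : Size234 2
  three : Size234 3
  four  : Size234 4

size234 : ∀ {n} → 2 ≤ n → n ≤ 4 → Size234 n
size234 {1} (s≤s ())
size234 {2} _ _ = two
size234 {3} _ _ = three
size234 {4} _ _ = four
size234 {suc (suc (suc (suc (suc _))))} _ (s≤s (s≤s (s≤s (s≤s ()))))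

size234-bounds : ∀ {n} → Size234 n → 2 ≤ n × n ≤ 4
size234-bounds two   = ≤ᵇ⇒≤ _ _ _ , ≤ᵇ⇒≤ _ _ _
size234-bounds three = ≤ᵇ⇒≤ _ _ _ , ≤ᵇ⇒≤ _ _ _
size234-bounds four  = ≤ᵇ⇒≤ _ _ _ , ≤ᵇ⇒≤ _ _ _

s₀-2+ : ∀ t → 2 * s₀ t ≤ s₀ (2 + t)
s₀-2+ 0 = ≤ᵇ⇒≤ _ _ _
s₀-2+ 1 = ≤ᵇ⇒≤ _ _ _
s₀-2+ 2 = ≤ᵇ⇒≤ _ _ _
s₀-2+ 3 = ≤ᵇ⇒≤ _ _ _
s₀-2+ 4 = ≤ᵇ⇒≤ _ _ _
s₀-2+ (suc (suc (suc t@(suc (suc _))))) = begin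
  2 * (3 * s₀ t)  ≡⟨ trans (sym (*-assoc 2 3 (s₀ t))) (*-assoc 3 2 (s₀ t)) ⟩
  3 * (2 * s₀ t)  ≤⟨ *-monoʳ-≤ 3 (s₀-2+ t) ⟩
  3 * s₀ (2 + t)  ∎
  where open ≤-Reasoning

s₀-3+ : ∀ t → 3 * s₀ t ≤ s₀ (3 + t)
s₀-3+ 0 = ≤ᵇ⇒≤ _ _ _
s₀-3+ 1 = ≤ᵇ⇒≤ _ _ _
s₀-3+ (suc (suc t)) = ≤-refl

*-s₀≤s₀-+ : ∀ {d} → Size234 d → ∀ t → d * s₀ t ≤ s₀ (d + t)
*-s₀≤s₀-+ two   = s₀-2+
*-s₀≤s₀-+ three = s₀-3+
*-s₀≤s₀-+ four t = begin
  4 * s₀ t        ≡⟨ *-assoc 2 2 (s₀ t) ⟩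
  2 * (2 * s₀ t)  ≤⟨ *-monoʳ-≤ 2 (s₀-2+ t) ⟩
  2 * s₀ (2 + t)  ≤⟨ s₀-2+ (2 + t) ⟩
  s₀ (4 + t)      ∎
  where open ≤-Reasoning

product≤s₀[sum] : ∀ {ns} → All Size234 ns → product ns ≤ s₀ (sum ns)
product≤s₀[sum] []                = ≤-refl
product≤s₀[sum] {d ∷ ns} (sz ∷ szs) =
  ≤-trans (*-monoʳ-≤ d (product≤s₀[sum] szs)) (*-s₀≤s₀-+ sz (sum ns))

#clauses : ℕ → ℕ → ℕ → ℕ
#clauses a b c = 2 * a + 3 * b + 4 * c

#models : ℕ → ℕ → ℕ → ℕ
#models a b c = 2 ^ a * 3 ^ b * 4 ^ c

occurrences : ℕ → List ℕ → ℕ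
occurrences i ns = length (filter (_≟ i) ns)

-- The ring solver does not unfold #clauses and #models, hence the unfolded identities.
#clauses-suc₂ : ∀ a b c → #clauses (suc a) b c ≡ 2 + #clauses a b c
#clauses-suc₂ = identity
  where identity : ∀ a b c → 2 * suc a + 3 * b + 4 * c ≡ 2 + (2 * a + 3 * b + 4 * c)
        identity = solve-∀

#clauses-suc₃ : ∀ a b c → #clauses a (suc b) c ≡ 3 + #clauses a b c
#clauses-suc₃ = identity
  where identity : ∀ a b c → 2 * a + 3 * suc b + 4 * c ≡ 3 + (2 * a + 3 * b + 4 * c)
        identity = solve-∀

#clauses-suc₄ : ∀ a b c → #clauses a b (suc c) ≡ 4 + #clauses a b c
#clauses-suc₄ = identity
  where identity : ∀ a b c → 2 * a + 3 * b + 4 * suc c ≡ 4 + (2 * a + 3 * b + 4 * c)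
        identity = solve-∀

#models-suc₂ : ∀ a b c → #models (suc a) b c ≡ 2 * #models a b c
#models-suc₂ a b c = identity (2 ^ a) (3 ^ b) (4 ^ c)
  where identity : ∀ x y z → 2 * x * y * z ≡ 2 * (x * y * z)
        identity = solve-∀

#models-suc₃ : ∀ a b c → #models a (suc b) c ≡ 3 * #models a b c
#models-suc₃ a b c = identity (2 ^ a) (3 ^ b) (4 ^ c)
  where identity : ∀ x y z → x * (3 * y) * z ≡ 3 * (x * y * z)
        identity = solve-∀

#models-suc₄ : ∀ a b c → #models a b (suc c) ≡ 4 * #models a b c
#models-suc₄ a b c = identity (2 ^ a) (3 ^ b) (4 ^ c)
  where identity : ∀ x y z → x * y * (4 * z) ≡ 4 * (x * y * z)
        identity = solve-∀

sum≡#clauses : ∀ {ns} → All Size234 ns →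
               sum ns ≡ #clauses (occurrences 2 ns) (occurrences 3 ns) (occurrences 4 ns)
sum≡#clauses []                    = refl
sum≡#clauses {_ ∷ ns} (two ∷ szs)   =
  trans (cong (2 +_) (sum≡#clauses szs))
        (sym (#clauses-suc₂ (occurrences 2 ns) (occurrences 3 ns) (occurrences 4 ns)))
sum≡#clauses {_ ∷ ns} (three ∷ szs) =
  trans (cong (3 +_) (sum≡#clauses szs))
        (sym (#clauses-suc₃ (occurrences 2 ns) (occurrences 3 ns) (occurrences 4 ns)))
sum≡#clauses {_ ∷ ns} (four ∷ szs)  =
  trans (cong (4 +_) (sum≡#clauses szs))
        (sym (#clauses-suc₄ (occurrences 2 ns) (occurrences 3 ns) (occurrences 4 ns)))

product≡#models : ∀ {ns} → All Size234 ns →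
                  product ns ≡ #models (occurrences 2 ns) (occurrences 3 ns) (occurrences 4 ns)
product≡#models []                    = refl
product≡#models {_ ∷ ns} (two ∷ szs)   =
  trans (cong (2 *_) (product≡#models szs))
        (sym (#models-suc₂ (occurrences 2 ns) (occurrences 3 ns) (occurrences 4 ns)))
product≡#models {_ ∷ ns} (three ∷ szs) =
  trans (cong (3 *_) (product≡#models szs))
        (sym (#models-suc₃ (occurrences 2 ns) (occurrences 3 ns) (occurrences 4 ns)))
product≡#models {_ ∷ ns} (four ∷ szs)  =
  trans (cong (4 *_) (product≡#models szs))
        (sym (#models-suc₄ (occurrences 2 ns) (occurrences 3 ns) (occurrences 4 ns)))

#models>0 : ∀ a b c → 0 < #models a b c
#models>0 a b c = *-mono-≤ (*-mono-≤ (m^n>0 2 a) (m^n>0 3 b)) (m^n>0 4 c)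

MaximalSignature : ℕ → ℕ → ℕ → Set
MaximalSignature a b c =
  ∀ a′ b′ c′ → #clauses a′ b′ c′ ≡ #clauses a b c → #models a′ b′ c′ ≤ #models a b c

maximal⇒no-9/8-gain : ∀ a b c → MaximalSignature a b c →
                      ∀ a′ b′ c′ → #clauses a′ b′ c′ ≡ #clauses a b c →
                      8 * #models a′ b′ c′ ≢ 9 * #models a b c
maximal⇒no-9/8-gain a b c max a′ b′ c′ same ratio =
  <-irrefl ratio (≤-<-trans (*-monoʳ-≤ 8 (max a′ b′ c′ same)) (m<n+m _ (#models>0 a b c)))

data NormalSignature : ℕ → ℕ → ℕ → Set where
  no-2-no-4 : ∀ b → NormalSignature 0 b 0
  one-2     : ∀ b → NormalSignature 1 b 0
  two-2     : ∀ b → NormalSignature 2 b 0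
  one-4     : ∀ b → NormalSignature 0 b 1

maximal⇒normal : ∀ a b c → MaximalSignature a b c → NormalSignature a b c
maximal⇒normal 0 b 0 _ = no-2-no-4 b
maximal⇒normal 1 b 0 _ = one-2 b
maximal⇒normal 2 b 0 _ = two-2 b
maximal⇒normal 0 b 1 _ = one-4 b
maximal⇒normal (suc (suc (suc a))) b c max =
  ⊥-elim (maximal⇒no-9/8-gain (3 + a) b c max a (2 + b) c
            (clauses a b c) (models (2 ^ a) (3 ^ b) (4 ^ c)))
  where
  clauses : ∀ a b c → 2 * a + 3 * (2 + b) + 4 * c ≡ 2 * (3 + a) + 3 * b + 4 * c
  clauses = solve-∀
  models : ∀ x y z → 8 * (x * (3 * (3 * y)) * z) ≡ 9 * (2 * (2 * (2 * x)) * y * z)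
  models = solve-∀
maximal⇒normal a b (suc (suc c)) max =
  ⊥-elim (maximal⇒no-9/8-gain a b (2 + c) max (1 + a) (2 + b) c
            (clauses a b c) (models (2 ^ a) (3 ^ b) (4 ^ c)))
  where
  clauses : ∀ a b c → 2 * (1 + a) + 3 * (2 + b) + 4 * c ≡ 2 * a + 3 * b + 4 * (2 + c)
  clauses = solve-∀
  models : ∀ x y z → 8 * (2 * x * (3 * (3 * y)) * z) ≡ 9 * (x * y * (4 * (4 * z)))
  models = solve-∀
maximal⇒normal (suc a) b (suc c) max =
  ⊥-elim (maximal⇒no-9/8-gain (1 + a) b (1 + c) max a (2 + b) c
            (clauses a b c) (models (2 ^ a) (3 ^ b) (4 ^ c)))
  where
  clauses : ∀ a b c → 2 * a + 3 * (2 + b) + 4 * c ≡ 2 * (1 + a) + 3 * b + 4 * (1 + c)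
  clauses = solve-∀
  models : ∀ x y z → 8 * (x * (3 * (3 * y)) * z) ≡ 9 * (2 * x * y * (4 * z))
  models = solve-∀

[3q+r]%3≡r : ∀ q {r} → r < 3 → (3 * q + r) % 3 ≡ r
[3q+r]%3≡r q {r} r<3 = begin
  (3 * q + r) % 3  ≡⟨ cong (_% 3) (trans (+-comm (3 * q) r) (cong (r +_) (*-comm 3 q))) ⟩
  (r + q * 3) % 3  ≡⟨ [m+kn]%n≡m%n r q 3 ⟩
  r % 3            ≡⟨ m<n⇒m%n≡m r<3 ⟩
  r                ∎
  where open ≡-Reasoning

3q+r-injective : ∀ {q q′ r r′} → r < 3 → r′ < 3 → 3 * q + r ≡ 3 * q′ + r′ → q ≡ q′ × r ≡ r′
3q+r-injective {q} {q′} {r} {r′} r<3 r′<3 eq = q≡q′ , r≡r′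
  where
  r≡r′ : r ≡ r′
  r≡r′ = trans (sym ([3q+r]%3≡r q r<3)) (trans (cong (_% 3) eq) ([3q+r]%3≡r q′ r′<3))
  q≡q′ : q ≡ q′
  q≡q′ = *-cancelˡ-≡ q q′ 3 (+-cancelʳ-≡ r′ (3 * q) (3 * q′)
                               (subst (λ x → 3 * q + x ≡ 3 * q′ + r′) r≡r′ eq))

quotient residue : ∀ {a b c} → NormalSignature a b c → ℕ
quotient (no-2-no-4 b) = b
quotient (one-2 b)     = b
quotient (two-2 b)     = suc b
quotient (one-4 b)     = suc b
residue (no-2-no-4 _) = 0
residue (one-2 _)     = 2
residue (two-2 _)     = 1
residue (one-4 _)     = 1

residue<3 : ∀ {a b c} (N : NormalSignature a b c) → residue N < 3
residue<3 (no-2-no-4 _) = s≤s z≤n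
residue<3 (one-2 _)     = s≤s (s≤s (s≤s z≤n))
residue<3 (two-2 _)     = s≤s (s≤s z≤n)
residue<3 (one-4 _)     = s≤s (s≤s z≤n)

#clauses-normal : ∀ {a b c} (N : NormalSignature a b c) →
                  #clauses a b c ≡ 3 * quotient N + residue N
#clauses-normal (no-2-no-4 b) = refl
#clauses-normal (one-2 b)     = identity b
  where identity : ∀ b → 2 * 1 + 3 * b + 4 * 0 ≡ 3 * b + 2
        identity = solve-∀
#clauses-normal (two-2 b)     = identity b
  where identity : ∀ b → 2 * 2 + 3 * b + 4 * 0 ≡ 3 * (1 + b) + 1
        identity = solve-∀
#clauses-normal (one-4 b)     = identity b
  where identity : ∀ b → 2 * 0 + 3 * b + 4 * 1 ≡ 3 * (1 + b) + 1
        identity = solve-∀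

normal-divMod : ∀ {a b c q r} (N : NormalSignature a b c) → r < 3 → #clauses a b c ≡ 3 * q + r →
                quotient N ≡ q × residue N ≡ r
normal-divMod N r<3 eq = 3q+r-injective (residue<3 N) r<3 (trans (sym (#clauses-normal N)) eq)

normal-3k : ∀ {a b c k} → NormalSignature a b c → #clauses a b c ≡ 3 * k → (a , b , c) ≡ (0 , k , 0)
normal-3k {k = k} N eq with normal-divMod {q = k} N (s≤s z≤n) (trans eq (sym (+-identityʳ _)))
normal-3k (no-2-no-4 _) _ | refl , _ = refl
normal-3k (one-2 _)     _ | _ , ()
normal-3k (two-2 _)     _ | _ , ()
normal-3k (one-4 _)     _ | _ , ()

normal-3k+4 : ∀ {a b c k} → NormalSignature a b c → #clauses a b c ≡ 3 * suc k + 1 →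
              (a , b , c) ≡ (2 , k , 0) ⊎ (a , b , c) ≡ (0 , k , 1)
normal-3k+4 {k = k} N eq with normal-divMod {q = suc k} N (s≤s (s≤s z≤n)) eq
normal-3k+4 (no-2-no-4 _) _ | _ , ()
normal-3k+4 (one-2 _)     _ | _ , ()
normal-3k+4 (two-2 _)     _ | refl , _ = inj₁ refl
normal-3k+4 (one-4 _)     _ | refl , _ = inj₂ refl

normal-3k+2 : ∀ {a b c k} → NormalSignature a b c → #clauses a b c ≡ 3 * k + 2 →
              (a , b , c) ≡ (1 , k , 0)
normal-3k+2 {k = k} N eq with normal-divMod {q = k} N (s≤s (s≤s (s≤s z≤n))) eq
normal-3k+2 (no-2-no-4 _) _ | _ , ()
normal-3k+2 (one-2 _)     _ | refl , _ = refl
normal-3k+2 (two-2 _)     _ | _ , ()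
normal-3k+2 (one-4 _)     _ | _ , ()

s₀-attained : ∀ n → 2 ≤ n → ∃ λ a → ∃ λ b → ∃ λ c → #clauses a b c ≡ n × #models a b c ≡ s₀ n
s₀-attained 1 (s≤s ())
s₀-attained 2 _ = 1 , 0 , 0 , refl , refl
s₀-attained 3 _ = 0 , 1 , 0 , refl , refl
s₀-attained 4 _ = 2 , 0 , 0 , refl , refl
s₀-attained (suc (suc (suc n@(suc (suc _))))) _
  with a , b , c , clauses≡n , models≡s₀ ← s₀-attained n (s≤s (s≤s z≤n))
  = a , suc b , c , trans (#clauses-suc₃ a b c) (cong (3 +_) clauses≡n)
                  , trans (#models-suc₃ a b c) (cong (3 *_) models≡s₀)

-- 2,3,4-programs

sizes-partition : ∀ {m} {Bs : List (List (Fin m))} → IsPartition234 Bs → All Size234 (map length Bs)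
sizes-partition (bounds , _) = All.map⁺ (All.map (λ (2≤ , ≤4) → size234 2≤ ≤4) bounds)

numStable-partition : ∀ {m} {P : Program m} {Bs} → IsPartition234 Bs → P ↭ concatMap CP Bs →
                      NumStable P (product (map length Bs))
numStable-partition {m} {Bs = Bs} (bounds , Bs↭atoms) P↭CPs =
  numStable-CP P↭CPs unique (All.map (inhabited ∘ proj₁) bounds)
  where
  unique : Unique (concat Bs)
  unique = ↭ₛ.Unique-resp-↭ (≡.setoid _) (↭⇒↭ₛ (↭-sym Bs↭atoms)) (Unique.allFin⁺ m)
  inhabited : ∀ {A : List (Fin m)} → 2 ≤ length A → ∃ (_∈ₗ A)
  inhabited {x ∷ _} _ = x , here refl

length-concatMap-CP : ∀ {m} (Bs : List (List (Fin m))) →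
                      length (concatMap CP Bs) ≡ sum (map length Bs)
length-concatMap-CP []       = refl
length-concatMap-CP (A ∷ Bs) =
  trans (length-++ (CP A)) (cong₂ _+_ (length-map _ A) (length-concatMap-CP Bs))

length-CPs : ∀ {m} {P : Program m} Bs → P ↭ concatMap CP Bs → length P ≡ sum (map length Bs)
length-CPs Bs P↭CPs = trans (↭.↭-length P↭CPs) (length-concatMap-CP Bs)

countSize≡occurrences : ∀ {m} i (Bs : List (List (Fin m))) →
                        countSize i Bs ≡ occurrences i (map length Bs)
countSize≡occurrences i []       = refl
countSize≡occurrences i (A ∷ Bs) with does (length A ≟ i)
... | true  = cong suc (countSize≡occurrences i Bs)
... | false = countSize≡occurrences i Bs

signature-counts : ∀ {m} {P : Program m} {a b c} → HasSignature P a b c →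
                   NumStable P (#models a b c) × length P ≡ #clauses a b c
signature-counts {P = P} (Bs , partition , P↭CPs , refl , refl , refl)
  rewrite countSize≡occurrences 2 Bs | countSize≡occurrences 3 Bs | countSize≡occurrences 4 Bs
  = subst (NumStable P) (product≡#models sizes) (numStable-partition partition P↭CPs)
  , trans (length-CPs Bs P↭CPs) (sum≡#clauses sizes)
  where sizes = sizes-partition partition

numStable≤s₀[length] : ∀ {m} {P : Program m} {s} → Is234 P → NumStable P s → s ≤ s₀ (length P)
numStable≤s₀[length] {P = P} (_ , _ , _ , Bs , partition , P↭CPs , _) numStable =
  subst₂ _≤_ (numStable-unique {P = P} (numStable-partition partition P↭CPs) numStable)
             (cong s₀ (sym (length-CPs Bs P↭CPs)))
             (product≤s₀[sum] (sizes-partition partition))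

HasSignature-resp : ∀ {m} {P : Program m} {a b c a′ b′ c′} →
                    (a , b , c) ≡ (a′ , b′ , c′) → HasSignature P a b c → HasSignature P a′ b′ c′
HasSignature-resp refl sig = sig

sizes : ℕ → ℕ → ℕ → List ℕ
sizes (suc a) b       c       = 2 ∷ sizes a b c
sizes 0       (suc b) c       = 3 ∷ sizes 0 b c
sizes 0       0       (suc c) = 4 ∷ sizes 0 0 c
sizes 0       0       0       = []

sizes-size234 : ∀ a b c → All Size234 (sizes a b c)
sizes-size234 (suc a) b       c       = two ∷ sizes-size234 a b c
sizes-size234 0       (suc b) c       = three ∷ sizes-size234 0 b c
sizes-size234 0       0       (suc c) = four ∷ sizes-size234 0 0 c
sizes-size234 0       0       0       = []

occurrences-sizes : ∀ a b c → let ns = sizes a b c in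
                    (occurrences 2 ns , occurrences 3 ns , occurrences 4 ns) ≡ (a , b , c)
occurrences-sizes (suc a) b       c       = cong (map₁ suc) (occurrences-sizes a b c)
occurrences-sizes 0       (suc b) c       = cong (map₂ (map₁ suc)) (occurrences-sizes 0 b c)
occurrences-sizes 0       0       (suc c) = cong (map₂ (map₂ suc)) (occurrences-sizes 0 0 c)
occurrences-sizes 0       0       0       = refl

signature-realizable : ∀ a b c → ∃ λ m → Σ (Program m) λ P → HasSignature P a b c
signature-realizable a b c = sum ns , concatMap CP Bs , HasSignature-resp (occurrences-sizes a b c)
  (Bs , (bounds , ↭-reflexive (concat-chunks ns (allFin _) (length-tabulate id))) , ↭-refl ,
   counts 2 , counts 3 , counts 4)
  where
  ns = sizes a b c
  Bs = chunks ns (allFin (sum ns))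
  lengths : map length Bs ≡ ns
  lengths = map-length-chunks ns (allFin _) (length-tabulate id)
  bounds : All (λ A → 2 ≤ length A × length A ≤ 4) Bs
  bounds = All.map⁻ (subst (All _) (sym lengths) (All.map size234-bounds (sizes-size234 a b c)))
  counts : ∀ i → countSize i Bs ≡ occurrences i ns
  counts i = trans (countSize≡occurrences i Bs) (cong (occurrences i) lengths)

s₀-realizable : ∀ n → 2 ≤ n →
                Σ ℕ λ m → Σ (Program m) λ P → Is234 P × length P ≡ n × NumStable P (s₀ n)
s₀-realizable n 2≤n
  with a , b , c , #clauses≡n , #models≡s₀ ← s₀-attained n 2≤n
  with m , P , sig ← signature-realizable a b c
  with numStable , length≡#clauses ← signature-counts sig
  = m , P , (a , b , c , sig) , trans length≡#clauses #clauses≡n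
  , subst (NumStable P) #models≡s₀ numStable

maximal⇒normal-signature : ∀ {n m} {P : Program m} → IsMaximal n P →
  ∃ λ a → ∃ λ b → ∃ λ c → NormalSignature a b c × #clauses a b c ≡ n × HasSignature P a b c
maximal⇒normal-signature {n} {P = P} ((a , b , c , sig) , length≡n , s , numStable , maximum) =
  a , b , c , maximal⇒normal a b c maximal , #clauses≡n , sig
  where
  #clauses≡n : #clauses a b c ≡ n
  #clauses≡n = trans (sym (proj₂ (signature-counts sig))) length≡n
  maximal : MaximalSignature a b c
  maximal a′ b′ c′ same
    with m′ , P′ , sig′ ← signature-realizable a′ b′ c′
    with numStable′ , length′ ← signature-counts sig′
    = subst (#models a′ b′ c′ ≤_)
            (numStable-unique {P = P} numStable (proj₁ (signature-counts sig)))
            (maximum m′ P′ (a′ , b′ , c′ , sig′) (trans length′ (trans same #clauses≡n)) _ numStable′)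

corollary5 :
    (∀ n m (P : Program m) → IsMaximal n P →
        (∀ k → 1 ≤ k → n ≡ 3 * k → HasSignature P 0 k 0)
      × (∀ k → n ≡ 3 * suc k + 1 → HasSignature P 2 k 0 ⊎ HasSignature P 0 k 1)
      × (∀ k → n ≡ 3 * k + 2 → HasSignature P 1 k 0))
    × (∀ n → 2 ≤ n →
        (Σ ℕ λ m → Σ (Program m) λ P → Is234 P × length P ≡ n × NumStable P (s₀ n))
      × (∀ m (P : Program m) → Is234 P → length P ≡ n → ∀ s → NumStable P s → s ≤ s₀ n))
corollary5 =
  (λ n m P maximal →
    let a , b , c , N , #clauses≡n , sig = maximal⇒normal-signature maximal in
      (λ k _ n≡3k → HasSignature-resp (normal-3k N (trans #clauses≡n n≡3k)) sig)
    , (λ k n≡3k+4 → Sum.map (flip HasSignature-resp sig) (flip HasSignature-resp sig)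
                            (normal-3k+4 N (trans #clauses≡n n≡3k+4)))
    , (λ k n≡3k+2 → HasSignature-resp (normal-3k+2 N (trans #clauses≡n n≡3k+2)) sig))
  , λ n 2≤n →
      s₀-realizable n 2≤n
    , λ m P is234 length≡n s numStable →
        subst (λ l → s ≤ s₀ l) length≡n (numStable≤s₀[length] is234 numStable)
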